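{- For $n\ge 0$, the number $B^*(n,0)$ of non-constant, non-canalizing Boolean functions on $n$ variables is $$B^*(n,0)=2^{2^n}-2\big((-1)^n-n\big)+\sum_{k=1}^n(-1)^k\binom{n}{k}2^{k+1}2^{2^{n-k}}.$$
   Context: A Boolean function on $n$ variables is a map $\mathbb{F}_2^n\to\mathbb{F}_2$. It is canalizing if there exist a variable $x_i$ and $a,b\in\mathbb{F}_2$ such that $f=b$ whenever $x_i=a$, while the function obtained by setting $x_i=a+1$ is not identically $b$. In particular constant functions are not canalizing. -}

module Defs where

open import Data.Bool using (Bool; true; false; not)
open import Data.Nat using (ℕ; zero; suc) renaming (_^_ to _^ℕ_; _∸_ to _∸ℕ_)
open import Data.Nat.Combinatorics using (_C_)
open import Data.Fin using (Fin)
open import Data.Vec using (Vec; []; _∷_; lookup)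
open import Data.List using (List; []; _∷_; concatMap; map; foldr; upTo)
open import Data.Integer using (ℤ; +_; -_; _+_; _-_; _*_; _^_)
open import Data.Product using (Σ; ∃; _×_; _,_)
open import Relation.Nullary using (¬_)
open import Relation.Binary.PropositionalEquality using (_≡_)

BoolFun : ℕ → Set
BoolFun n = Vec Bool n → Bool

Constant : ∀ {n} → BoolFun n → Set
Constant {n} f = Σ Bool λ b → (x : Vec Bool n) → f x ≡ b

Canalizing : ∀ {n} → BoolFun n → Set
Canalizing {n} f =
  Σ (Fin n) λ i → Σ Bool λ a → Σ Bool λ b →
    ((x : Vec Bool n) → lookup x i ≡ a → f x ≡ b) ×
    ¬ ((x : Vec Bool n) → lookup x i ≡ not a → f x ≡ b)

NonConstNonCanal : ∀ {n} → BoolFun n → Set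
NonConstNonCanal f = ¬ Constant f × ¬ Canalizing f

-- Enumeration of all Boolean functions on n variables (each exactly once,
-- up to pointwise equality): a function on n+1 variables is given by its two
-- restrictions x₀ = false and x₀ = true.
allFuns : (n : ℕ) → List (BoolFun n)
allFuns zero = (λ _ → false) ∷ (λ _ → true) ∷ []
allFuns (suc n) =
  concatMap (λ g → map (λ h → combine g h) (allFuns n)) (allFuns n)
  where
  combine : BoolFun n → BoolFun n → BoolFun (suc n)
  combine g h (false ∷ xs) = g xs
  combine g h (true ∷ xs) = h xs

-- Sum over k = 1..n of a ℤ-valued term
sumℤ1to : ℕ → (ℕ → ℤ) → ℤ
sumℤ1to n t = foldr (λ k acc → t (suc k) + acc) (+ 0) (upTo n)

formula : ℕ → ℤ
formula n =
  (+ (2 ^ℕ (2 ^ℕ n)))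
  - (+ 2) * (((- (+ 1)) ^ n) - (+ n))
  + sumℤ1to n (λ k → ((- (+ 1)) ^ k) * (+ (n C k))
                      * (+ (2 ^ℕ (suc k))) * (+ (2 ^ℕ (2 ^ℕ (n ∸ℕ k)))))

-- For n ≥ 1 a function is non-constant and non-canalizing exactly when it is constant
-- on no face {x ∣ xᵢ = a} of the cube, so we count functions having neither a face with
-- constant value 1 nor one with constant value 0.  The counts are generalised to r-tuples
-- of functions and faces common to all of them, because then they satisfy a recursion:
-- splitting on x₀, a tuple of (n+1)-variable functions has a common face with value c iff
-- its cofactors at x₀ = 0 are all ≡ c, or its cofactors at x₀ = 1 are, or the 2r-tuple of
-- both cofactors has a common such face.  By inclusion–exclusion the number Φ(n, r) of
-- tuples without a common c-face satisfies Φ(n+1, r) = Φ(n, 2r) − 2 Φ(n, r) + [n = 0],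
-- which is solved by a binomial sum in −2 over the tuple counts (2^2^m)^r.  In the same way,
-- for every r ≥ 1 exactly 2n r-tuples have common faces with both values (for r = 1 these
-- are the literals xᵢ and ¬xᵢ), and a last inclusion–exclusion over the two values gives
-- the formula.

module Submission where

open import Defs
open import Data.Bool using (Bool; true; false; not; _∧_; _∨_; _xor_; _≟_)
open import Data.Bool.Properties using (¬-not; ∧-assoc; ∧-zeroʳ; ∧-identityʳ; ∨-assoc; ∨-zeroʳ; ∧-conicalˡ; ∧-conicalʳ; ∧-commutativeMonoid)
open import Algebra.Bundles using (CommutativeMonoid)
open import Algebra.Properties.CommutativeSemigroup (CommutativeMonoid.commutativeSemigroup ∧-commutativeMonoid) using (interchange)
open import Data.Fin using (Fin; zero; suc)
open import Data.List using (List; []; _∷_; _++_; map; concatMap; foldr; applyUpTo; upTo; length; filter)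
open import Data.List.Properties using (applyUpTo-∷ʳ)
open import Data.Nat as ℕ using (ℕ; zero; suc; z≤n; s≤s; _<_; _≡ᵇ_)
import Data.Nat.Properties as ℕ
open import Data.Nat.Combinatorics using (_C_; nCk+nC[k+1]≡[n+1]C[k+1]; k>n⇒nCk≡0)
open import Data.Integer using (ℤ; +_; -_; _+_; _-_; _*_; _^_)
open import Data.Integer.Properties using (+-identityʳ; +-identityˡ; +-assoc; *-comm; *-identityˡ; pos-+; pos-*; ^-distribˡ-+-*; ^-zeroˡ)
open import Data.Integer.Tactic.RingSolver using (solve-∀)
open import Data.Vec using (Vec; []; _∷_; lookup) renaming (_++_ to _++ᵥ_; map to mapᵥ)
open import Data.Product using (Σ; _,_; proj₁)
open import Data.Empty using (⊥-elim)
open import Function using (_∘_; id)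
open import Relation.Nullary using (¬_; yes; no)
open import Relation.Unary using (Decidable)
open import Relation.Binary.PropositionalEquality

private variable
  A B : Set

∑ : List A → (A → ℤ) → ℤ
∑ []       w = + 0
∑ (x ∷ xs) w = w x + ∑ xs w

∑-cong : ∀ (xs : List A) {v w : A → ℤ} → (∀ x → v x ≡ w x) → ∑ xs v ≡ ∑ xs w
∑-cong []       _  = refl
∑-cong (x ∷ xs) eq = cong₂ _+_ (eq x) (∑-cong xs eq)

∑-++ : ∀ (xs ys : List A) (w : A → ℤ) → ∑ (xs ++ ys) w ≡ ∑ xs w + ∑ ys w
∑-++ []       ys w = sym (+-identityˡ _)
∑-++ (x ∷ xs) ys w = trans (cong (λ s → w x + s) (∑-++ xs ys w)) (sym (+-assoc (w x) _ _))

∑-map : ∀ (xs : List A) (f : A → B) (w : B → ℤ) → ∑ (map f xs) w ≡ ∑ xs (w ∘ f)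
∑-map []       f w = refl
∑-map (x ∷ xs) f w = cong (λ s → w (f x) + s) (∑-map xs f w)

∑-concatMap : ∀ (xs : List A) (f : A → List B) (w : B → ℤ) →
              ∑ (concatMap f xs) w ≡ ∑ xs (λ x → ∑ (f x) w)
∑-concatMap []       f w = refl
∑-concatMap (x ∷ xs) f w = trans (∑-++ (f x) _ w) (cong (λ s → ∑ (f x) w + s) (∑-concatMap xs f w))

∑-zero : ∀ (xs : List A) → ∑ xs (λ _ → + 0) ≡ + 0
∑-zero []       = refl
∑-zero (x ∷ xs) = trans (+-identityˡ _) (∑-zero xs)

∑-+ : ∀ (xs : List A) (v w : A → ℤ) → ∑ xs (λ x → v x + w x) ≡ ∑ xs v + ∑ xs w
∑-+ []       v w = refl
∑-+ (x ∷ xs) v w = trans (cong (λ s → v x + w x + s) (∑-+ xs v w)) (middleFour (v x) (w x) _ _)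
  where
  middleFour : ∀ a b c d → a + b + (c + d) ≡ a + c + (b + d)
  middleFour = solve-∀

∑-neg : ∀ (xs : List A) (w : A → ℤ) → ∑ xs (λ x → - w x) ≡ - ∑ xs w
∑-neg []       w = refl
∑-neg (x ∷ xs) w = trans (cong (λ s → - w x + s) (∑-neg xs w)) (negSum (w x) _)
  where
  negSum : ∀ a b → - a + - b ≡ - (a + b)
  negSum = solve-∀

∑-- : ∀ (xs : List A) (v w : A → ℤ) → ∑ xs (λ x → v x - w x) ≡ ∑ xs v - ∑ xs w
∑-- xs v w = trans (∑-+ xs v (λ x → - w x)) (cong (λ s → ∑ xs v + s) (∑-neg xs w))

∑-*ˡ : ∀ (xs : List A) (c : ℤ) (w : A → ℤ) → ∑ xs (λ x → c * w x) ≡ c * ∑ xs w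
∑-*ˡ []       c w = sym (*-comm c (+ 0))
∑-*ˡ (x ∷ xs) c w = trans (cong (λ s → c * w x + s) (∑-*ˡ xs c w)) (distrib c (w x) _)
  where
  distrib : ∀ c a b → c * a + c * b ≡ c * (a + b)
  distrib = solve-∀

∑-*ʳ : ∀ (xs : List A) (c : ℤ) (w : A → ℤ) → ∑ xs (λ x → w x * c) ≡ ∑ xs w * c
∑-*ʳ xs c w = trans (∑-cong xs (λ x → *-comm (w x) c)) (trans (∑-*ˡ xs c w) (*-comm c _))

∑-swap : ∀ (xs : List A) (ys : List B) (w : A → B → ℤ) →
         ∑ xs (λ x → ∑ ys (w x)) ≡ ∑ ys (λ y → ∑ xs (λ x → w x y))
∑-swap []       ys w = sym (∑-zero ys)
∑-swap (x ∷ xs) ys w = trans (cong (λ s → ∑ ys (w x) + s) (∑-swap xs ys w)) (sym (∑-+ ys (w x) _))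

∑-product : ∀ (xs : List A) (ys : List B) (v : A → ℤ) (w : B → ℤ) →
            ∑ xs (λ x → ∑ ys (λ y → v x * w y)) ≡ ∑ xs v * ∑ ys w
∑-product xs ys v w = trans (∑-cong xs (λ x → ∑-*ˡ ys (v x) w)) (∑-*ʳ xs (∑ ys w) v)

foldr≡∑ : ∀ (w : A → ℤ) xs → foldr (λ x acc → w x + acc) (+ 0) xs ≡ ∑ xs w
foldr≡∑ w []       = refl
foldr≡∑ w (x ∷ xs) = cong (λ s → w x + s) (foldr≡∑ w xs)

⟦_⟧ : Bool → ℤ
⟦ true  ⟧ = + 1
⟦ false ⟧ = + 0

⟦∧⟧ : ∀ a b → ⟦ a ∧ b ⟧ ≡ ⟦ a ⟧ * ⟦ b ⟧
⟦∧⟧ true  true  = refl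
⟦∧⟧ true  false = refl
⟦∧⟧ false b     = refl

false≢true : false ≢ true
false≢true ()

length-filter≡∑ : ∀ {P : A → Set} (P? : Decidable P) (b : A → Bool) →
                  (∀ x → P x → b x ≡ true) → (∀ x → b x ≡ true → P x) →
                  ∀ xs → + length (filter P? xs) ≡ ∑ xs (λ x → ⟦ b x ⟧)
length-filter≡∑ P? b P⇒b b⇒P []       = refl
length-filter≡∑ P? b P⇒b b⇒P (x ∷ xs) with P? x | b x in bx
... | yes px | true  = cong (λ s → + 1 + s) (length-filter≡∑ P? b P⇒b b⇒P xs)
... | yes px | false = ⊥-elim (false≢true (trans (sym bx) (P⇒b x px)))
... | no ¬px | true  = ⊥-elim (¬px (b⇒P x bx))
... | no ¬px | false = trans (length-filter≡∑ P? b P⇒b b⇒P xs) (sym (+-identityˡ _))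

-- Binomial sums

∑-applyUpTo-cong : ∀ m (f g : ℕ → ℕ) (v w : ℕ → ℤ) → (∀ k → k < m → v (f k) ≡ w (g k)) →
                   ∑ (applyUpTo f m) v ≡ ∑ (applyUpTo g m) w
∑-applyUpTo-cong zero    f g v w eq = refl
∑-applyUpTo-cong (suc m) f g v w eq =
  cong₂ _+_ (eq 0 (s≤s z≤n)) (∑-applyUpTo-cong m (f ∘ suc) (g ∘ suc) v w (λ k k<m → eq (suc k) (s≤s k<m)))

∑-upTo-suc : ∀ m (w : ℕ → ℤ) → ∑ (upTo (suc m)) w ≡ ∑ (upTo m) w + w m
∑-upTo-suc m w = begin
  ∑ (upTo (suc m)) w          ≡⟨ cong (λ xs → ∑ xs w) (applyUpTo-∷ʳ id m) ⟨
  ∑ (upTo m ++ m ∷ []) w      ≡⟨ ∑-++ (upTo m) (m ∷ []) w ⟩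
  ∑ (upTo m) w + (w m + + 0)  ≡⟨ cong (λ s → ∑ (upTo m) w + s) (+-identityʳ (w m)) ⟩
  ∑ (upTo m) w + w m          ∎
  where open ≡-Reasoning

binomialSum : ℤ → ℕ → (ℕ → ℤ) → ℤ
binomialSum x n F = ∑ (upTo (suc n)) (λ k → + (n C k) * x ^ k * F (n ℕ.∸ k))

binomialSum-cong : ∀ x n {F G : ℕ → ℤ} → (∀ m → F m ≡ G m) → binomialSum x n F ≡ binomialSum x n G
binomialSum-cong x n eq = ∑-cong (upTo (suc n)) (λ k → cong (λ y → + (n C k) * x ^ k * y) (eq (n ℕ.∸ k)))

binomialSum-suc : ∀ x n (F : ℕ → ℤ) →
                  binomialSum x (suc n) F ≡ binomialSum x n (F ∘ suc) + x * binomialSum x n F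
binomialSum-suc x n F = begin
  binomialSum x (suc n) F
    ≡⟨ cong₂ _+_ (*-identityˡ (F (suc n))) (∑-applyUpTo-cong (suc n) suc id t (t ∘ suc) (λ _ _ → refl)) ⟩
  F (suc n) + ∑ (upTo (suc n)) (t ∘ suc)
    ≡⟨ cong (λ s → F (suc n) + s) (trans (∑-cong (upTo (suc n)) pascal) (∑-+ (upTo (suc n)) α β)) ⟩
  F (suc n) + (∑ (upTo (suc n)) α + ∑ (upTo (suc n)) β)
    ≡⟨ cong₂ (λ a b → F (suc n) + (a + b)) (∑-*ˡ (upTo (suc n)) x (λ k → + (n C k) * x ^ k * F (n ℕ.∸ k)))
                                             (∑-upTo-suc n β) ⟩
  F (suc n) + (x * binomialSum x n F + (∑ (upTo n) β + β n))
    ≡⟨ cong (λ b → F (suc n) + (x * binomialSum x n F + (∑ (upTo n) β + b))) βₙ≡0 ⟩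
  F (suc n) + (x * binomialSum x n F + (∑ (upTo n) β + + 0))
    ≡⟨ rearrange (F (suc n)) _ _ ⟩
  F (suc n) + ∑ (upTo n) β + x * binomialSum x n F
    ≡⟨ cong (_+ x * binomialSum x n F) shift ⟩
  binomialSum x n (F ∘ suc) + x * binomialSum x n F
    ∎
  where
  open ≡-Reasoning
  t α β : ℕ → ℤ
  t k = + (suc n C k) * x ^ k * F (suc n ℕ.∸ k)
  α k = x * (+ (n C k) * x ^ k * F (n ℕ.∸ k))
  β k = + (n C suc k) * x ^ suc k * F (n ℕ.∸ k)

  pascal : ∀ k → t (suc k) ≡ α k + β k
  pascal k = begin
    + (suc n C suc k) * x ^ suc k * F (n ℕ.∸ k)
      ≡⟨ cong (λ c → + c * x ^ suc k * F (n ℕ.∸ k)) (sym (nCk+nC[k+1]≡[n+1]C[k+1] n k)) ⟩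
    + (n C k ℕ.+ n C suc k) * x ^ suc k * F (n ℕ.∸ k)
      ≡⟨ cong (λ c → c * x ^ suc k * F (n ℕ.∸ k)) (pos-+ (n C k) (n C suc k)) ⟩
    (+ (n C k) + + (n C suc k)) * (x * x ^ k) * F (n ℕ.∸ k)
      ≡⟨ distrib (+ (n C k)) (+ (n C suc k)) x (x ^ k) (F (n ℕ.∸ k)) ⟩
    α k + β k ∎
    where
    distrib : ∀ a b x p f → (a + b) * (x * p) * f ≡ x * (a * p * f) + b * (x * p) * f
    distrib = solve-∀

  βₙ≡0 : β n ≡ + 0
  βₙ≡0 = cong (λ c → + c * x ^ suc n * F (n ℕ.∸ n)) (k>n⇒nCk≡0 (ℕ.n<1+n n))

  rearrange : ∀ f b s → f + (b + (s + + 0)) ≡ f + s + b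
  rearrange = solve-∀

  shift : F (suc n) + ∑ (upTo n) β ≡ binomialSum x n (F ∘ suc)
  shift = cong₂ _+_ (sym (*-identityˡ (F (suc n))))
    (∑-applyUpTo-cong n id suc β (λ k → + (n C k) * x ^ k * F (suc (n ℕ.∸ k)))
      (λ k k<n → cong (λ m → + (n C suc k) * x ^ suc k * F m) (ℕ.+-∸-assoc 1 k<n)))

pos-^ : ∀ m k → + (m ℕ.^ k) ≡ (+ m) ^ k
pos-^ m zero    = refl
pos-^ m (suc k) = trans (pos-* m (m ℕ.^ k)) (cong (+ m *_) (pos-^ m k))

^-distribʳ-* : ∀ (x y : ℤ) r → (x * y) ^ r ≡ x ^ r * y ^ r
^-distribʳ-* x y zero    = refl
^-distribʳ-* x y (suc r) = trans (cong ((x * y) *_) (^-distribʳ-* x y r)) (regroup x y (x ^ r) (y ^ r))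
  where
  regroup : ∀ x y a b → x * y * (a * b) ≡ x * a * (y * b)
  regroup = solve-∀

-- Tuples

allᵥ : ∀ {r} → (A → Bool) → Vec A r → Bool
allᵥ p []       = true
allᵥ p (x ∷ xs) = p x ∧ allᵥ p xs

allᵥ-map : ∀ {r} (p : B → Bool) (f : A → B) (xs : Vec A r) → allᵥ p (mapᵥ f xs) ≡ allᵥ (p ∘ f) xs
allᵥ-map p f []       = refl
allᵥ-map p f (x ∷ xs) = cong (p (f x) ∧_) (allᵥ-map p f xs)

allᵥ-++ : ∀ {r s} (p : A → Bool) (xs : Vec A r) (ys : Vec A s) → allᵥ p (xs ++ᵥ ys) ≡ allᵥ p xs ∧ allᵥ p ys
allᵥ-++ p []       ys = refl
allᵥ-++ p (x ∷ xs) ys = trans (cong (p x ∧_) (allᵥ-++ p xs ys)) (sym (∧-assoc (p x) _ _))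

allᵥ-∧ : ∀ {r} (p q : A → Bool) (xs : Vec A r) → allᵥ (λ x → p x ∧ q x) xs ≡ allᵥ p xs ∧ allᵥ q xs
allᵥ-∧ p q []       = refl
allᵥ-∧ p q (x ∷ xs) = trans (cong ((p x ∧ q x) ∧_) (allᵥ-∧ p q xs)) (interchange (p x) (q x) _ _)

allᵥ-mono : ∀ {r} {p q : A → Bool} → (∀ x → p x ≡ true → q x ≡ true) →
            (xs : Vec A r) → allᵥ p xs ≡ true → allᵥ q xs ≡ true
allᵥ-mono p⇒q []       _  = refl
allᵥ-mono p⇒q (x ∷ xs) eq =
  cong₂ _∧_ (p⇒q x (∧-conicalˡ _ _ eq)) (allᵥ-mono p⇒q xs (∧-conicalʳ _ _ eq))

allVecs : List A → (r : ℕ) → List (Vec A r)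
allVecs xs zero    = [] ∷ []
allVecs xs (suc r) = concatMap (λ x → map (x ∷_) (allVecs xs r)) xs

∑-allVecs-suc : ∀ (xs : List A) r (w : Vec A (suc r) → ℤ) →
                ∑ (allVecs xs (suc r)) w ≡ ∑ xs (λ x → ∑ (allVecs xs r) (w ∘ (x ∷_)))
∑-allVecs-suc xs r w = trans (∑-concatMap xs _ w) (∑-cong xs (λ x → ∑-map (allVecs xs r) (x ∷_) w))

∑-allVecs-1 : ∀ (xs : List A) (w : Vec A 1 → ℤ) → ∑ (allVecs xs 1) w ≡ ∑ xs (λ x → w (x ∷ []))
∑-allVecs-1 xs w = trans (∑-allVecs-suc xs 0 w) (∑-cong xs (λ x → +-identityʳ (w (x ∷ []))))

∑-allVecs-++ : ∀ (xs : List A) r s (w : Vec A (r ℕ.+ s) → ℤ) →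
               ∑ (allVecs xs (r ℕ.+ s)) w ≡ ∑ (allVecs xs r) (λ u → ∑ (allVecs xs s) (w ∘ (u ++ᵥ_)))
∑-allVecs-++ xs zero    s w = sym (+-identityʳ _)
∑-allVecs-++ xs (suc r) s w = begin
  ∑ (allVecs xs (suc r ℕ.+ s)) w
    ≡⟨ ∑-allVecs-suc xs (r ℕ.+ s) w ⟩
  ∑ xs (λ x → ∑ (allVecs xs (r ℕ.+ s)) (w ∘ (x ∷_)))
    ≡⟨ ∑-cong xs (λ x → ∑-allVecs-++ xs r s (w ∘ (x ∷_))) ⟩
  ∑ xs (λ x → ∑ (allVecs xs r) (λ u → ∑ (allVecs xs s) (w ∘ ((x ∷ u) ++ᵥ_))))
    ≡⟨ ∑-allVecs-suc xs r (λ u → ∑ (allVecs xs s) (w ∘ (u ++ᵥ_))) ⟨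
  ∑ (allVecs xs (suc r)) (λ u → ∑ (allVecs xs s) (w ∘ (u ++ᵥ_)))
    ∎
  where open ≡-Reasoning

∑-allVecs-const : ∀ (xs : List A) r → ∑ (allVecs xs r) (λ _ → + 1) ≡ ∑ xs (λ _ → + 1) ^ r
∑-allVecs-const xs zero    = refl
∑-allVecs-const xs (suc r) = trans (∑-allVecs-suc xs r _)
  (trans (∑-product xs (allVecs xs r) (λ _ → + 1) (λ _ → + 1))
         (cong (∑ xs (λ _ → + 1) *_) (∑-allVecs-const xs r)))

∑-allVecs-allᵥ : ∀ (xs : List A) r (p : A → Bool) →
                 ∑ (allVecs xs r) (λ t → ⟦ allᵥ p t ⟧) ≡ ∑ xs (λ x → ⟦ p x ⟧) ^ r
∑-allVecs-allᵥ xs zero    p = refl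
∑-allVecs-allᵥ xs (suc r) p = begin
  ∑ (allVecs xs (suc r)) (λ t → ⟦ allᵥ p t ⟧)
    ≡⟨ ∑-allVecs-suc xs r _ ⟩
  ∑ xs (λ x → ∑ (allVecs xs r) (λ t → ⟦ p x ∧ allᵥ p t ⟧))
    ≡⟨ ∑-cong xs (λ x → ∑-cong (allVecs xs r) (λ t → ⟦∧⟧ (p x) (allᵥ p t))) ⟩
  ∑ xs (λ x → ∑ (allVecs xs r) (λ t → ⟦ p x ⟧ * ⟦ allᵥ p t ⟧))
    ≡⟨ ∑-product xs (allVecs xs r) _ _ ⟩
  ∑ xs (λ x → ⟦ p x ⟧) * ∑ (allVecs xs r) (λ t → ⟦ allᵥ p t ⟧)
    ≡⟨ cong (∑ xs (λ x → ⟦ p x ⟧) *_) (∑-allVecs-allᵥ xs r p) ⟩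
  ∑ xs (λ x → ⟦ p x ⟧) ^ suc r
    ∎
  where open ≡-Reasoning

-- Cofactors

lo hi : ∀ {n} → BoolFun (suc n) → BoolFun n
lo f xs = f (false ∷ xs)
hi f xs = f (true ∷ xs)

∑-allFuns-suc : ∀ n (G : BoolFun n → BoolFun n → ℤ) →
                ∑ (allFuns (suc n)) (λ f → G (lo f) (hi f)) ≡ ∑ (allFuns n) (λ g → ∑ (allFuns n) (G g))
∑-allFuns-suc n G = trans (∑-concatMap (allFuns n) _ _) (∑-cong (allFuns n) (λ g → ∑-map (allFuns n) _ _))

∑-allVecs-allFuns-suc : ∀ n r (W : Vec (BoolFun n) r → Vec (BoolFun n) r → ℤ) →
  ∑ (allVecs (allFuns (suc n)) r) (λ t → W (mapᵥ lo t) (mapᵥ hi t)) ≡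
  ∑ (allVecs (allFuns n) r) (λ u → ∑ (allVecs (allFuns n) r) (W u))
∑-allVecs-allFuns-suc n zero    W = cong (_+ + 0) (sym (+-identityʳ (W [] [])))
∑-allVecs-allFuns-suc n (suc r) W = begin
  ∑ (allVecs Fₙ₊₁ (suc r)) (λ t → W (mapᵥ lo t) (mapᵥ hi t))
    ≡⟨ ∑-allVecs-suc Fₙ₊₁ r _ ⟩
  ∑ Fₙ₊₁ (λ f → ∑ (allVecs Fₙ₊₁ r) (λ t → W (lo f ∷ mapᵥ lo t) (hi f ∷ mapᵥ hi t)))
    ≡⟨ ∑-allFuns-suc n (λ g h → ∑ (allVecs Fₙ₊₁ r) (λ t → W (g ∷ mapᵥ lo t) (h ∷ mapᵥ hi t))) ⟩
  ∑ Fₙ (λ g → ∑ Fₙ (λ h → ∑ (allVecs Fₙ₊₁ r) (λ t → W (g ∷ mapᵥ lo t) (h ∷ mapᵥ hi t))))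
    ≡⟨ ∑-cong Fₙ (λ g → ∑-cong Fₙ (λ h → ∑-allVecs-allFuns-suc n r (λ u v → W (g ∷ u) (h ∷ v)))) ⟩
  ∑ Fₙ (λ g → ∑ Fₙ (λ h → ∑ (allVecs Fₙ r) (λ u → ∑ (allVecs Fₙ r) (λ v → W (g ∷ u) (h ∷ v)))))
    ≡⟨ ∑-cong Fₙ (λ g → ∑-swap Fₙ (allVecs Fₙ r) _) ⟩
  ∑ Fₙ (λ g → ∑ (allVecs Fₙ r) (λ u → ∑ Fₙ (λ h → ∑ (allVecs Fₙ r) (λ v → W (g ∷ u) (h ∷ v)))))
    ≡⟨ ∑-cong Fₙ (λ g → ∑-cong (allVecs Fₙ r) (λ u → ∑-allVecs-suc Fₙ r (W (g ∷ u)))) ⟨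
  ∑ Fₙ (λ g → ∑ (allVecs Fₙ r) (λ u → ∑ (allVecs Fₙ (suc r)) (W (g ∷ u))))
    ≡⟨ ∑-allVecs-suc Fₙ r (λ u → ∑ (allVecs Fₙ (suc r)) (W u)) ⟨
  ∑ (allVecs Fₙ (suc r)) (λ u → ∑ (allVecs Fₙ (suc r)) (W u))
    ∎
  where
  open ≡-Reasoning
  Fₙ : List (BoolFun n)
  Fₙ = allFuns n
  Fₙ₊₁ : List (BoolFun (suc n))
  Fₙ₊₁ = allFuns (suc n)

2^2^suc : ∀ n → 2 ℕ.^ (2 ℕ.^ suc n) ≡ 2 ℕ.^ (2 ℕ.^ n) ℕ.* 2 ℕ.^ (2 ℕ.^ n)
2^2^suc n = trans (cong (λ e → 2 ℕ.^ (2 ℕ.^ n ℕ.+ e)) (ℕ.+-identityʳ (2 ℕ.^ n)))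
                  (ℕ.^-distribˡ-+-* 2 (2 ℕ.^ n) (2 ℕ.^ n))

#allFuns : ∀ n → ∑ (allFuns n) (λ _ → + 1) ≡ + (2 ℕ.^ (2 ℕ.^ n))
#allFuns zero    = refl
#allFuns (suc n) = begin
  ∑ (allFuns (suc n)) (λ _ → + 1)
    ≡⟨ ∑-allFuns-suc n (λ _ _ → + 1) ⟩
  ∑ (allFuns n) (λ _ → ∑ (allFuns n) (λ _ → + 1))
    ≡⟨ ∑-product (allFuns n) (allFuns n) (λ _ → + 1) (λ _ → + 1) ⟩
  ∑ (allFuns n) (λ _ → + 1) * ∑ (allFuns n) (λ _ → + 1)
    ≡⟨ cong₂ _*_ (#allFuns n) (#allFuns n) ⟩
  + (2 ℕ.^ (2 ℕ.^ n)) * + (2 ℕ.^ (2 ℕ.^ n))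
    ≡⟨ pos-* (2 ℕ.^ (2 ℕ.^ n)) _ ⟨
  + (2 ℕ.^ (2 ℕ.^ n) ℕ.* 2 ℕ.^ (2 ℕ.^ n))
    ≡⟨ cong +_ (2^2^suc n) ⟨
  + (2 ℕ.^ (2 ℕ.^ suc n)) ∎
  where open ≡-Reasoning

#tuples : ℕ → ℕ → ℤ
#tuples n r = (+ (2 ℕ.^ (2 ℕ.^ n))) ^ r

#tuples-suc : ∀ n r → #tuples (suc n) r ≡ #tuples n (r ℕ.+ r)
#tuples-suc n r = begin
  (+ (2 ℕ.^ (2 ℕ.^ suc n))) ^ r
    ≡⟨ cong (λ m → (+ m) ^ r) (2^2^suc n) ⟩
  (+ (N ℕ.* N)) ^ r
    ≡⟨ cong (_^ r) (pos-* N N) ⟩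
  (+ N * + N) ^ r
    ≡⟨ ^-distribʳ-* (+ N) (+ N) r ⟩
  (+ N) ^ r * (+ N) ^ r
    ≡⟨ ^-distribˡ-+-* (+ N) r r ⟨
  (+ N) ^ (r ℕ.+ r) ∎
  where
  open ≡-Reasoning
  N : ℕ
  N = 2 ℕ.^ (2 ℕ.^ n)

-- Constancy on faces

anyFin : ∀ n → (Fin n → Bool) → Bool
anyFin zero    p = false
anyFin (suc n) p = p zero ∨ anyFin n (p ∘ suc)

anyFin-cong : ∀ n {p q : Fin n → Bool} → (∀ i → p i ≡ q i) → anyFin n p ≡ anyFin n q
anyFin-cong zero    eq = refl
anyFin-cong (suc n) eq = cong₂ _∨_ (eq zero) (anyFin-cong n (eq ∘ suc))

anyFin-false : ∀ n {p : Fin n → Bool} → (∀ i → p i ≡ false) → anyFin n p ≡ false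
anyFin-false zero    eq = refl
anyFin-false (suc n) eq rewrite eq zero = anyFin-false n (eq ∘ suc)

anyFin-sound : ∀ n (p : Fin n → Bool) → anyFin n p ≡ true → Σ (Fin n) λ i → p i ≡ true
anyFin-sound (suc n) p eq with p zero in p₀
... | true  = zero , p₀
... | false with anyFin-sound n (p ∘ suc) eq
...   | i , pᵢ = suc i , pᵢ

anyFin-complete : ∀ n (p : Fin n → Bool) i → p i ≡ true → anyFin n p ≡ true
anyFin-complete (suc n) p zero    pᵢ rewrite pᵢ = refl
anyFin-complete (suc n) p (suc i) pᵢ with p zero
... | true  = refl
... | false = anyFin-complete n (p ∘ suc) i pᵢ

isConst : Bool → ∀ {n} → BoolFun n → Bool
isConst c {zero}  f = not (f [] xor c)
isConst c {suc n} f = isConst c (lo f) ∧ isConst c (hi f)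

isConstOn : Bool → ∀ {n} → Fin n → Bool → BoolFun n → Bool
isConstOn c zero    a f = isConst c (λ xs → f (a ∷ xs))
isConstOn c (suc i) a f = isConstOn c i a (lo f) ∧ isConstOn c i a (hi f)

allConst : Bool → ∀ {n r} → Vec (BoolFun n) r → Bool
allConst c = allᵥ (isConst c)

hasCommonFace : Bool → ∀ {n r} → Vec (BoolFun n) r → Bool
hasCommonFace c {n} fs = anyFin n (λ i → allᵥ (isConstOn c i false) fs ∨ allᵥ (isConstOn c i true) fs)

hasCommonFace-suc : ∀ c {n r} (fs : Vec (BoolFun (suc n)) r) →
  hasCommonFace c fs ≡
  allConst c (mapᵥ lo fs) ∨ allConst c (mapᵥ hi fs) ∨ hasCommonFace c (mapᵥ lo fs ++ᵥ mapᵥ hi fs)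
hasCommonFace-suc c {n} fs = trans
  (cong₂ _∨_ (cong₂ _∨_ (sym (allᵥ-map (isConst c) lo fs)) (sym (allᵥ-map (isConst c) hi fs)))
             (anyFin-cong n (λ i → cong₂ _∨_ (split i false) (split i true))))
  (∨-assoc (allConst c (mapᵥ lo fs)) _ _)
  where
  split : ∀ i a → allᵥ (isConstOn c (suc i) a) fs ≡ allᵥ (isConstOn c i a) (mapᵥ lo fs ++ᵥ mapᵥ hi fs)
  split i a = begin
    allᵥ (isConstOn c (suc i) a) fs
      ≡⟨ allᵥ-∧ (isConstOn c i a ∘ lo) (isConstOn c i a ∘ hi) fs ⟩
    allᵥ (isConstOn c i a ∘ lo) fs ∧ allᵥ (isConstOn c i a ∘ hi) fs
      ≡⟨ cong₂ _∧_ (allᵥ-map _ lo fs) (allᵥ-map _ hi fs) ⟨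
    allᵥ (isConstOn c i a) (mapᵥ lo fs) ∧ allᵥ (isConstOn c i a) (mapᵥ hi fs)
      ≡⟨ allᵥ-++ _ (mapᵥ lo fs) (mapᵥ hi fs) ⟨
    allᵥ (isConstOn c i a) (mapᵥ lo fs ++ᵥ mapᵥ hi fs)
      ∎
    where open ≡-Reasoning

isConst-not : ∀ c {n} (f : BoolFun n) → isConst c f ≡ true → isConst (not c) f ≡ false
isConst-not c {zero}  f eq with f [] | c
... | false | false = refl
... | true  | true  = refl
isConst-not c {suc n} f eq rewrite isConst-not c (lo f) (∧-conicalˡ _ _ eq) = refl

isConst⇒isConstOn : ∀ c {n} (i : Fin n) a (f : BoolFun n) → isConst c f ≡ true → isConstOn c i a f ≡ true
isConst⇒isConstOn c zero    false f eq = ∧-conicalˡ _ _ eq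
isConst⇒isConstOn c zero    true  f eq = ∧-conicalʳ _ _ eq
isConst⇒isConstOn c (suc i) a     f eq =
  cong₂ _∧_ (isConst⇒isConstOn c i a (lo f) (∧-conicalˡ _ _ eq))
            (isConst⇒isConstOn c i a (hi f) (∧-conicalʳ _ _ eq))

isConst⇒¬isConstOn-not : ∀ c {n} (i : Fin n) a (f : BoolFun n) →
                         isConst c f ≡ true → isConstOn (not c) i a f ≡ false
isConst⇒¬isConstOn-not c zero    a f eq = isConst-not c (λ xs → f (a ∷ xs)) (isConst⇒isConstOn c zero a f eq)
isConst⇒¬isConstOn-not c (suc i) a f eq
  rewrite isConst⇒¬isConstOn-not c i a (lo f) (∧-conicalˡ _ _ eq) = refl

allConst⇒hasCommonFace-++ˡ : ∀ c {n r s} (us : Vec (BoolFun n) r) (vs : Vec (BoolFun n) s) →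
                             allConst c us ≡ true → hasCommonFace c (us ++ᵥ vs) ≡ hasCommonFace c vs
allConst⇒hasCommonFace-++ˡ c {n} us vs eq = anyFin-cong n (λ i → cong₂ _∨_ (drop i false) (drop i true))
  where
  drop : ∀ i a → allᵥ (isConstOn c i a) (us ++ᵥ vs) ≡ allᵥ (isConstOn c i a) vs
  drop i a = trans (allᵥ-++ _ us vs) (cong (_∧ allᵥ _ vs) (allᵥ-mono (isConst⇒isConstOn c i a) us eq))

allConst⇒hasCommonFace-++ʳ : ∀ c {n r s} (us : Vec (BoolFun n) r) (vs : Vec (BoolFun n) s) →
                             allConst c vs ≡ true → hasCommonFace c (us ++ᵥ vs) ≡ hasCommonFace c us
allConst⇒hasCommonFace-++ʳ c {n} us vs eq = anyFin-cong n (λ i → cong₂ _∨_ (drop i false) (drop i true))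
  where
  drop : ∀ i a → allᵥ (isConstOn c i a) (us ++ᵥ vs) ≡ allᵥ (isConstOn c i a) us
  drop i a = trans (allᵥ-++ _ us vs)
    (trans (cong (allᵥ _ us ∧_) (allᵥ-mono (isConst⇒isConstOn c i a) vs eq)) (∧-identityʳ _))

allConst⇒hasCommonFace : ∀ c {n r} (fs : Vec (BoolFun n) r) →
                         allConst c fs ≡ true → hasCommonFace c fs ≡ not (n ≡ᵇ 0)
allConst⇒hasCommonFace c {zero}  fs eq = refl
allConst⇒hasCommonFace c {suc n} fs eq =
  cong (λ b → (b ∨ allᵥ (isConstOn c zero true) fs) ∨ anyFin n (λ i → faceAt (suc i)))
       (allᵥ-mono (isConst⇒isConstOn c zero false) fs eq)
  where
  faceAt : Fin (suc n) → Bool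
  faceAt i = allᵥ (isConstOn c i false) fs ∨ allᵥ (isConstOn c i true) fs

isConst⇒¬hasCommonFace-not : ∀ c {n r s} (us : Vec (BoolFun n) r) f (vs : Vec (BoolFun n) s) →
                             isConst c f ≡ true → hasCommonFace (not c) (us ++ᵥ f ∷ vs) ≡ false
isConst⇒¬hasCommonFace-not c {n} us f vs eq = anyFin-false n (λ i → cong₂ _∨_ (kill i false) (kill i true))
  where
  kill : ∀ i a → allᵥ (isConstOn (not c) i a) (us ++ᵥ f ∷ vs) ≡ false
  kill i a = trans (allᵥ-++ _ us (f ∷ vs))
    (trans (cong (λ b → allᵥ _ us ∧ b ∧ allᵥ _ vs) (isConst⇒¬isConstOn-not c i a f eq)) (∧-zeroʳ _))

-- Faces and canalization

ConstOnSomeFace : Bool → ∀ {n} → BoolFun n → Set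
ConstOnSomeFace c {n} f = Σ (Fin n) λ i → Σ Bool λ a → (x : Vec Bool n) → lookup x i ≡ a → f x ≡ c

not-xor≡true : ∀ x c → not (x xor c) ≡ true → x ≡ c
not-xor≡true false false _ = refl
not-xor≡true true  true  _ = refl

isConst-sound : ∀ c {n} (f : BoolFun n) → isConst c f ≡ true → ∀ x → f x ≡ c
isConst-sound c {zero}  f eq []           = not-xor≡true (f []) c eq
isConst-sound c {suc n} f eq (false ∷ xs) = isConst-sound c (lo f) (∧-conicalˡ _ _ eq) xs
isConst-sound c {suc n} f eq (true  ∷ xs) = isConst-sound c (hi f) (∧-conicalʳ _ _ eq) xs

isConst-complete : ∀ c {n} (f : BoolFun n) → (∀ x → f x ≡ c) → isConst c f ≡ true
isConst-complete false {zero}  f const rewrite const [] = refl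
isConst-complete true  {zero}  f const rewrite const [] = refl
isConst-complete c     {suc n} f const =
  cong₂ _∧_ (isConst-complete c (lo f) (const ∘ (false ∷_))) (isConst-complete c (hi f) (const ∘ (true ∷_)))

isConstOn-sound : ∀ c {n} (i : Fin n) a (f : BoolFun n) → isConstOn c i a f ≡ true →
                  ∀ x → lookup x i ≡ a → f x ≡ c
isConstOn-sound c zero    a f eq (b ∷ xs)     refl = isConst-sound c (λ xs → f (b ∷ xs)) eq xs
isConstOn-sound c (suc i) a f eq (false ∷ xs) xᵢ≡a = isConstOn-sound c i a (lo f) (∧-conicalˡ _ _ eq) xs xᵢ≡a
isConstOn-sound c (suc i) a f eq (true  ∷ xs) xᵢ≡a = isConstOn-sound c i a (hi f) (∧-conicalʳ _ _ eq) xs xᵢ≡a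

isConstOn-complete : ∀ c {n} (i : Fin n) a (f : BoolFun n) → (∀ x → lookup x i ≡ a → f x ≡ c) →
                     isConstOn c i a f ≡ true
isConstOn-complete c zero    a f const = isConst-complete c (λ xs → f (a ∷ xs)) (λ xs → const (a ∷ xs) refl)
isConstOn-complete c (suc i) a f const = cong₂ _∧_
  (isConstOn-complete c i a (lo f) (const ∘ (false ∷_)))
  (isConstOn-complete c i a (hi f) (const ∘ (true ∷_)))

hasCommonFace-sound : ∀ c {n} (f : BoolFun n) → hasCommonFace c (f ∷ []) ≡ true → ConstOnSomeFace c f
hasCommonFace-sound c {n} f eq with anyFin-sound n _ eq
... | i , _ with isConstOn c i false f in e₀ | isConstOn c i true f in e₁
...   | true  | _    = i , false , isConstOn-sound c i false f e₀
...   | false | true = i , true , isConstOn-sound c i true f e₁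

hasCommonFace-complete : ∀ c {n} (f : BoolFun n) → ConstOnSomeFace c f → hasCommonFace c (f ∷ []) ≡ true
hasCommonFace-complete c {n} f (i , false , const) =
  anyFin-complete n _ i (cong (λ b → b ∧ true ∨ isConstOn c i true f ∧ true) (isConstOn-complete c i false f const))
hasCommonFace-complete c {n} f (i , true  , const) =
  anyFin-complete n _ i
    (trans (cong (λ b → isConstOn c i false f ∧ true ∨ b ∧ true) (isConstOn-complete c i true f const)) (∨-zeroʳ _))

ConstOnSomeFace⇒¬NonConstNonCanal : ∀ c {n} (f : BoolFun n) → ConstOnSomeFace c f → ¬ NonConstNonCanal f
ConstOnSomeFace⇒¬NonConstNonCanal c f (i , a , onFace) (nonConst , nonCanal) =
  nonCanal (i , a , c , onFace , λ offFace → nonConst (c , everywhere offFace))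
  where
  everywhere : (∀ x → lookup x i ≡ not a → f x ≡ c) → ∀ x → f x ≡ c
  everywhere offFace x with lookup x i ≟ a
  ... | yes xᵢ≡a = onFace x xᵢ≡a
  ... | no  xᵢ≢a = offFace x (¬-not xᵢ≢a)

noConstantFace : ∀ {n} → BoolFun n → Bool
noConstantFace f = not (hasCommonFace true (f ∷ [])) ∧ not (hasCommonFace false (f ∷ []))

NonConstNonCanal⇒noConstantFace : ∀ {n} (f : BoolFun n) → NonConstNonCanal f → noConstantFace f ≡ true
NonConstNonCanal⇒noConstantFace f ncc with hasCommonFace true (f ∷ []) in e₁ | hasCommonFace false (f ∷ []) in e₀
... | true  | _     = ⊥-elim (ConstOnSomeFace⇒¬NonConstNonCanal true f (hasCommonFace-sound true f e₁) ncc)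
... | false | true  = ⊥-elim (ConstOnSomeFace⇒¬NonConstNonCanal false f (hasCommonFace-sound false f e₀) ncc)
... | false | false = refl

noConstantFace⇒¬ConstOnSomeFace : ∀ {n} (f : BoolFun n) → noConstantFace f ≡ true → ∀ c → ¬ ConstOnSomeFace c f
noConstantFace⇒¬ConstOnSomeFace f eq true face =
  false≢true (trans (sym (cong not (hasCommonFace-complete true f face))) (∧-conicalˡ _ _ eq))
noConstantFace⇒¬ConstOnSomeFace f eq false face =
  false≢true (trans (sym (cong not (hasCommonFace-complete false f face))) (∧-conicalʳ _ _ eq))

-- Without variables there are no faces, although both functions are constant.
noConstantFace⇒NonConstNonCanal : ∀ {n} (f : BoolFun (suc n)) → noConstantFace f ≡ true → NonConstNonCanal f
noConstantFace⇒NonConstNonCanal f eq =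
    (λ { (b , const) → noFace b (zero , false , λ x _ → const x) })
  , (λ { (i , a , b , onFace , _) → noFace b (i , a , onFace) })
  where
  noFace : ∀ c → ¬ ConstOnSomeFace c f
  noFace = noConstantFace⇒¬ConstOnSomeFace f eq

-- Counting

⟦¬∨∨⟧ : ∀ a b p pᵤ pᵥ d →
        (a ≡ true → p ≡ pᵥ) → (b ≡ true → p ≡ pᵤ) → (a ≡ true → b ≡ true → p ≡ not d) →
        ⟦ not (a ∨ b ∨ p) ⟧ ≡
        ⟦ not p ⟧ - ⟦ a ⟧ * ⟦ not pᵥ ⟧ - ⟦ b ⟧ * ⟦ not pᵤ ⟧ + ⟦ a ⟧ * (⟦ b ⟧ * ⟦ d ⟧)
⟦¬∨∨⟧ false false false _ _ _ _ _ _ = refl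
⟦¬∨∨⟧ false false true  _ _ _ _ _ _ = refl
⟦¬∨∨⟧ true  false p _ pᵥ _ a⇒ _ _ with a⇒ refl
⟦¬∨∨⟧ true  false false _ false _ _ _ _ | refl = refl
⟦¬∨∨⟧ true  false true  _ true  _ _ _ _ | refl = refl
⟦¬∨∨⟧ false true  p pᵤ _ _ _ b⇒ _ with b⇒ refl
⟦¬∨∨⟧ false true  false false _ _ _ _ _ | refl = refl
⟦¬∨∨⟧ false true  true  true  _ _ _ _ _ | refl = refl
⟦¬∨∨⟧ true  true  p pᵤ pᵥ d a⇒ b⇒ ab⇒ with a⇒ refl | b⇒ refl | ab⇒ refl refl
⟦¬∨∨⟧ true  true  _ _ _ false _ _ _ | refl | refl | refl = refl
⟦¬∨∨⟧ true  true  _ _ _ true  _ _ _ | refl | refl | refl = refl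

#isConst : ∀ c n → ∑ (allFuns n) (λ f → ⟦ isConst c f ⟧) ≡ + 1
#isConst false zero    = refl
#isConst true  zero    = refl
#isConst c     (suc n) = begin
  ∑ (allFuns (suc n)) (λ f → ⟦ isConst c (lo f) ∧ isConst c (hi f) ⟧)
    ≡⟨ ∑-allFuns-suc n (λ g h → ⟦ isConst c g ∧ isConst c h ⟧) ⟩
  ∑ (allFuns n) (λ g → ∑ (allFuns n) (λ h → ⟦ isConst c g ∧ isConst c h ⟧))
    ≡⟨ ∑-cong (allFuns n) (λ g → ∑-cong (allFuns n) (λ h → ⟦∧⟧ (isConst c g) (isConst c h))) ⟩
  ∑ (allFuns n) (λ g → ∑ (allFuns n) (λ h → ⟦ isConst c g ⟧ * ⟦ isConst c h ⟧))
    ≡⟨ ∑-product (allFuns n) (allFuns n) _ _ ⟩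
  ∑ (allFuns n) (λ g → ⟦ isConst c g ⟧) * ∑ (allFuns n) (λ h → ⟦ isConst c h ⟧)
    ≡⟨ cong₂ _*_ (#isConst c n) (#isConst c n) ⟩
  + 1 ∎
  where open ≡-Reasoning

#allConst : ∀ c n r → ∑ (allVecs (allFuns n) r) (λ fs → ⟦ allConst c fs ⟧) ≡ + 1
#allConst c n r = trans (∑-allVecs-allᵥ (allFuns n) r (isConst c)) (trans (cong (_^ r) (#isConst c n)) (^-zeroˡ r))

#noCommonFace : Bool → ℕ → ℕ → ℤ
#noCommonFace c n r = ∑ (allVecs (allFuns n) r) (λ fs → ⟦ not (hasCommonFace c fs) ⟧)

#noCommonFace-suc : ∀ c n r →
  #noCommonFace c (suc n) r ≡ #noCommonFace c n (r ℕ.+ r) - + 2 * #noCommonFace c n r + ⟦ n ≡ᵇ 0 ⟧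
#noCommonFace-suc c n r = begin
  #noCommonFace c (suc n) r
    ≡⟨ ∑-cong (allVecs (allFuns (suc n)) r) (λ fs → cong (⟦_⟧ ∘ not) (hasCommonFace-suc c fs)) ⟩
  ∑ (allVecs (allFuns (suc n)) r) (λ fs → W (mapᵥ lo fs) (mapᵥ hi fs))
    ≡⟨ ∑-allVecs-allFuns-suc n r W ⟩
  ∑ Tᵣ (λ us → ∑ Tᵣ (W us))
    ≡⟨ ∑-cong Tᵣ (λ us → ∑-cong Tᵣ (inclusionExclusion us)) ⟩
  ∑ Tᵣ (λ us → ∑ Tᵣ (λ vs → ν (us ++ᵥ vs) - κ us * ν vs - κ vs * ν us + κ us * (κ vs * d)))
    ≡⟨ ∑-cong Tᵣ (λ us → linearity Tᵣ _ _ _ _) ⟩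
  ∑ Tᵣ (λ us → ∑ Tᵣ (ν ∘ (us ++ᵥ_)) - ∑ Tᵣ (λ vs → κ us * ν vs)
                 - ∑ Tᵣ (λ vs → κ vs * ν us) + ∑ Tᵣ (λ vs → κ us * (κ vs * d)))
    ≡⟨ linearity Tᵣ _ _ _ _ ⟩
  ∑ Tᵣ (λ us → ∑ Tᵣ (ν ∘ (us ++ᵥ_))) - ∑ Tᵣ (λ us → ∑ Tᵣ (λ vs → κ us * ν vs))
    - ∑ Tᵣ (λ us → ∑ Tᵣ (λ vs → κ vs * ν us)) + ∑ Tᵣ (λ us → ∑ Tᵣ (λ vs → κ us * (κ vs * d)))
    ≡⟨ cong₂ _+_ (cong₂ _-_ (cong₂ _-_ (sym (∑-allVecs-++ (allFuns n) r r ν)) term₂) term₃) term₄ ⟩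
  #noCommonFace c n (r ℕ.+ r) - + 1 * Φ - + 1 * Φ + + 1 * (+ 1 * d)
    ≡⟨ collect (#noCommonFace c n (r ℕ.+ r)) Φ d ⟩
  #noCommonFace c n (r ℕ.+ r) - + 2 * Φ + d ∎
  where
  open ≡-Reasoning
  Tᵣ : List (Vec (BoolFun n) r)
  Tᵣ = allVecs (allFuns n) r
  Φ d : ℤ
  Φ = #noCommonFace c n r
  d = ⟦ n ≡ᵇ 0 ⟧
  κ ν : ∀ {s} → Vec (BoolFun n) s → ℤ
  κ fs = ⟦ allConst c fs ⟧
  ν fs = ⟦ not (hasCommonFace c fs) ⟧
  W : Vec (BoolFun n) r → Vec (BoolFun n) r → ℤ
  W us vs = ⟦ not (allConst c us ∨ allConst c vs ∨ hasCommonFace c (us ++ᵥ vs)) ⟧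

  inclusionExclusion : ∀ us vs → W us vs ≡ ν (us ++ᵥ vs) - κ us * ν vs - κ vs * ν us + κ us * (κ vs * d)
  inclusionExclusion us vs = ⟦¬∨∨⟧ _ _ _ _ _ _
    (allConst⇒hasCommonFace-++ˡ c us vs) (allConst⇒hasCommonFace-++ʳ c us vs)
    (λ cu cv → allConst⇒hasCommonFace c (us ++ᵥ vs) (trans (allᵥ-++ (isConst c) us vs) (cong₂ _∧_ cu cv)))

  linearity : ∀ {X : Set} (xs : List X) (a b e h : X → ℤ) →
              ∑ xs (λ x → a x - b x - e x + h x) ≡ ∑ xs a - ∑ xs b - ∑ xs e + ∑ xs h
  linearity xs a b e h = trans (∑-+ xs _ h)
    (cong (_+ ∑ xs h) (trans (∑-- xs _ e) (cong (_- ∑ xs e) (∑-- xs a b))))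

  term₂ : ∑ Tᵣ (λ us → ∑ Tᵣ (λ vs → κ us * ν vs)) ≡ + 1 * Φ
  term₂ = trans (∑-product Tᵣ Tᵣ κ ν) (cong (_* Φ) (#allConst c n r))

  term₃ : ∑ Tᵣ (λ us → ∑ Tᵣ (λ vs → κ vs * ν us)) ≡ + 1 * Φ
  term₃ = trans (∑-swap Tᵣ Tᵣ (λ us vs → κ vs * ν us)) term₂

  term₄ : ∑ Tᵣ (λ us → ∑ Tᵣ (λ vs → κ us * (κ vs * d))) ≡ + 1 * (+ 1 * d)
  term₄ = trans (∑-product Tᵣ Tᵣ κ (λ vs → κ vs * d))
    (cong₂ _*_ (#allConst c n r) (trans (∑-*ʳ Tᵣ d κ) (cong (_* d) (#allConst c n r))))

  collect : ∀ x y z → x - + 1 * y - + 1 * y + + 1 * (+ 1 * z) ≡ x - + 2 * y + z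
  collect = solve-∀

#noCommonFace-closed : ∀ c n r →
  #noCommonFace c n r ≡ binomialSum (- + 2) n (λ m → #tuples m r) + ⟦ n ≡ᵇ 0 ⟧ - (- + 1) ^ n
#noCommonFace-closed c zero    r = trans (∑-allVecs-const (allFuns 0) r) (padding (#tuples 0 r))
  where
  padding : ∀ x → x ≡ + 1 * x + + 0 + + 1 - + 1
  padding = solve-∀
#noCommonFace-closed c (suc n) r = begin
  #noCommonFace c (suc n) r
    ≡⟨ #noCommonFace-suc c n r ⟩
  #noCommonFace c n (r ℕ.+ r) - + 2 * #noCommonFace c n r + d
    ≡⟨ cong₂ (λ a b → a - + 2 * b + d) (#noCommonFace-closed c n (r ℕ.+ r)) (#noCommonFace-closed c n r) ⟩
  (Bₙ (λ m → #tuples m (r ℕ.+ r)) + d - s) - + 2 * (Bₙ (λ m → #tuples m r) + d - s) + d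
    ≡⟨ collect (Bₙ (λ m → #tuples m (r ℕ.+ r))) (Bₙ (λ m → #tuples m r)) d s ⟩
  Bₙ (λ m → #tuples m (r ℕ.+ r)) + - + 2 * Bₙ (λ m → #tuples m r) + + 0 - - + 1 * s
    ≡⟨ cong (λ b → b + - + 2 * Bₙ (λ m → #tuples m r) + + 0 - - + 1 * s)
            (binomialSum-cong (- + 2) n (λ m → #tuples-suc m r)) ⟨
  Bₙ (λ m → #tuples (suc m) r) + - + 2 * Bₙ (λ m → #tuples m r) + + 0 - - + 1 * s
    ≡⟨ cong (λ b → b + + 0 - - + 1 * s) (binomialSum-suc (- + 2) n (λ m → #tuples m r)) ⟨
  binomialSum (- + 2) (suc n) (λ m → #tuples m r) + + 0 - (- + 1) ^ suc n ∎
  where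
  open ≡-Reasoning
  Bₙ : (ℕ → ℤ) → ℤ
  Bₙ = binomialSum (- + 2) n
  d s : ℤ
  d = ⟦ n ≡ᵇ 0 ⟧
  s = (- + 1) ^ n
  collect : ∀ x y d s → (x + d - s) - + 2 * (y + d - s) + d ≡ x + - + 2 * y + + 0 - - + 1 * s
  collect = solve-∀

∧≡false : ∀ a {b} → (a ≡ true → b ≡ false) → a ∧ b ≡ false
∧≡false false _ = refl
∧≡false true  h = h refl

⟦∨∨∧∨∨⟧ : ∀ a₁ a₀ b₁ b₀ p q →
          a₁ ∧ a₀ ≡ false → b₁ ∧ b₀ ≡ false →
          a₁ ∧ q ≡ false → b₁ ∧ q ≡ false → a₀ ∧ p ≡ false → b₀ ∧ p ≡ false →
          ⟦ (a₁ ∨ b₁ ∨ p) ∧ (a₀ ∨ b₀ ∨ q) ⟧ ≡ ⟦ a₁ ⟧ * ⟦ b₀ ⟧ + ⟦ a₀ ⟧ * ⟦ b₁ ⟧ + ⟦ p ∧ q ⟧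
⟦∨∨∧∨∨⟧ true  true  _     _     _     _     () _  _  _  _  _
⟦∨∨∧∨∨⟧ true  false _     _     _     true  _  _  () _  _  _
⟦∨∨∧∨∨⟧ true  false _     true  true  false _  _  _  _  _  ()
⟦∨∨∧∨∨⟧ true  false _     true  false false _  _  _  _  _  _  = refl
⟦∨∨∧∨∨⟧ true  false _     false false false _  _  _  _  _  _  = refl
⟦∨∨∧∨∨⟧ true  false _     false true  false _  _  _  _  _  _  = refl
⟦∨∨∧∨∨⟧ false true  _     _     true  _     _  _  _  _  () _
⟦∨∨∧∨∨⟧ false true  true  true  _     _     _  () _  _  _  _
⟦∨∨∧∨∨⟧ false true  true  false false true  _  _  _  () _  _
⟦∨∨∧∨∨⟧ false true  true  false false false _  _  _  _  _  _  = refl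
⟦∨∨∧∨∨⟧ false true  false _     false _     _  _  _  _  _  _  = refl
⟦∨∨∧∨∨⟧ false false true  true  _     _     _  () _  _  _  _
⟦∨∨∧∨∨⟧ false false true  false _     true  _  _  _  () _  _
⟦∨∨∧∨∨⟧ false false true  false false false _  _  _  _  _  _  = refl
⟦∨∨∧∨∨⟧ false false true  false true  false _  _  _  _  _  _  = refl
⟦∨∨∧∨∨⟧ false false false true  true  _     _  _  _  _  _  ()
⟦∨∨∧∨∨⟧ false false false true  false _     _  _  _  _  _  _  = refl
⟦∨∨∧∨∨⟧ false false false false false _     _  _  _  _  _  _  = refl
⟦∨∨∧∨∨⟧ false false false false true  false _  _  _  _  _  _  = refl
⟦∨∨∧∨∨⟧ false false false false true  true  _  _  _  _  _  _  = refl

#bothCommonFaces : ℕ → ℕ → ℤ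
#bothCommonFaces n r = ∑ (allVecs (allFuns n) r) (λ fs → ⟦ hasCommonFace true fs ∧ hasCommonFace false fs ⟧)

#bothCommonFaces-suc : ∀ n r → #bothCommonFaces (suc n) (suc r) ≡ + 2 + #bothCommonFaces n (suc r ℕ.+ suc r)
#bothCommonFaces-suc n r = begin
  #bothCommonFaces (suc n) (suc r)
    ≡⟨ ∑-cong (allVecs (allFuns (suc n)) (suc r))
              (λ fs → cong₂ (λ a b → ⟦ a ∧ b ⟧) (hasCommonFace-suc true fs) (hasCommonFace-suc false fs)) ⟩
  ∑ (allVecs (allFuns (suc n)) (suc r)) (λ fs → W (mapᵥ lo fs) (mapᵥ hi fs))
    ≡⟨ ∑-allVecs-allFuns-suc n (suc r) W ⟩
  ∑ T (λ us → ∑ T (W us))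
    ≡⟨ ∑-cong T (λ us → ∑-cong T (inclusionExclusion us)) ⟩
  ∑ T (λ us → ∑ T (λ vs → κ true us * κ false vs + κ false us * κ true vs + PQ (us ++ᵥ vs)))
    ≡⟨ ∑-cong T (λ us → linearity T _ _ _) ⟩
  ∑ T (λ us → ∑ T (λ vs → κ true us * κ false vs) + ∑ T (λ vs → κ false us * κ true vs)
               + ∑ T (PQ ∘ (us ++ᵥ_)))
    ≡⟨ linearity T _ _ _ ⟩
  ∑ T (λ us → ∑ T (λ vs → κ true us * κ false vs)) + ∑ T (λ us → ∑ T (λ vs → κ false us * κ true vs))
    + ∑ T (λ us → ∑ T (PQ ∘ (us ++ᵥ_)))
    ≡⟨ cong₂ _+_ (cong₂ _+_ (#allConstPairs true false) (#allConstPairs false true))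
                 (sym (∑-allVecs-++ (allFuns n) (suc r) (suc r) PQ)) ⟩
  + 2 + #bothCommonFaces n (suc r ℕ.+ suc r) ∎
  where
  open ≡-Reasoning
  T : List (Vec (BoolFun n) (suc r))
  T = allVecs (allFuns n) (suc r)
  κ : Bool → Vec (BoolFun n) (suc r) → ℤ
  κ c fs = ⟦ allConst c fs ⟧
  PQ : ∀ {s} → Vec (BoolFun n) s → ℤ
  PQ fs = ⟦ hasCommonFace true fs ∧ hasCommonFace false fs ⟧
  W : Vec (BoolFun n) (suc r) → Vec (BoolFun n) (suc r) → ℤ
  W us vs = ⟦ (allConst true us ∨ allConst true vs ∨ hasCommonFace true (us ++ᵥ vs))
             ∧ (allConst false us ∨ allConst false vs ∨ hasCommonFace false (us ++ᵥ vs)) ⟧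

  notBoth : ∀ c f {s} (fs : Vec (BoolFun n) s) → allConst c (f ∷ fs) ∧ allConst (not c) (f ∷ fs) ≡ false
  notBoth c f fs =
    ∧≡false (allConst c (f ∷ fs)) (λ e → cong (_∧ allConst (not c) fs) (isConst-not c f (∧-conicalˡ _ _ e)))

  noOpposite : ∀ c {s t t′} (us : Vec (BoolFun n) s) f (vs : Vec (BoolFun n) t) (ws : Vec (BoolFun n) t′) →
               allConst c (f ∷ vs) ∧ hasCommonFace (not c) (us ++ᵥ f ∷ ws) ≡ false
  noOpposite c us f vs ws =
    ∧≡false (allConst c (f ∷ vs)) (λ e → isConst⇒¬hasCommonFace-not c us f ws (∧-conicalˡ _ _ e))

  inclusionExclusion : ∀ us vs → W us vs ≡ κ true us * κ false vs + κ false us * κ true vs + PQ (us ++ᵥ vs)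
  inclusionExclusion (f ∷ us) (g ∷ vs) = ⟦∨∨∧∨∨⟧
    (allConst true (f ∷ us)) (allConst false (f ∷ us)) (allConst true (g ∷ vs)) (allConst false (g ∷ vs))
    (hasCommonFace true (f ∷ us ++ᵥ g ∷ vs)) (hasCommonFace false (f ∷ us ++ᵥ g ∷ vs))
    (notBoth true f us) (notBoth true g vs)
    (noOpposite true [] f us (us ++ᵥ g ∷ vs)) (noOpposite true (f ∷ us) g vs vs)
    (noOpposite false [] f us (us ++ᵥ g ∷ vs)) (noOpposite false (f ∷ us) g vs vs)

  linearity : ∀ {X : Set} (xs : List X) (a b e : X → ℤ) →
              ∑ xs (λ x → a x + b x + e x) ≡ ∑ xs a + ∑ xs b + ∑ xs e
  linearity xs a b e = trans (∑-+ xs _ e) (cong (_+ ∑ xs e) (∑-+ xs a b))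

  #allConstPairs : ∀ c c′ → ∑ T (λ us → ∑ T (λ vs → κ c us * κ c′ vs)) ≡ + 1
  #allConstPairs c c′ =
    trans (∑-product T T (κ c) (κ c′)) (cong₂ _*_ (#allConst c n (suc r)) (#allConst c′ n (suc r)))

#bothCommonFaces-closed : ∀ n r → #bothCommonFaces n (suc r) ≡ + 2 * + n
#bothCommonFaces-closed zero    r = ∑-zero (allVecs (allFuns 0) (suc r))
#bothCommonFaces-closed (suc n) r = begin
  #bothCommonFaces (suc n) (suc r)
    ≡⟨ #bothCommonFaces-suc n r ⟩
  + 2 + #bothCommonFaces n (suc r ℕ.+ suc r)
    ≡⟨ cong (λ x → + 2 + x) (#bothCommonFaces-closed n (r ℕ.+ suc r)) ⟩
  + 2 + + 2 * + n
    ≡⟨ distrib (+ n) ⟩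
  + 2 * + suc n ∎
  where
  open ≡-Reasoning
  distrib : ∀ x → + 2 + + 2 * x ≡ + 2 * (+ 1 + x)
  distrib = solve-∀

⟦¬∧¬⟧ : ∀ a b → ⟦ not a ∧ not b ⟧ ≡ ⟦ not a ⟧ + ⟦ not b ⟧ - + 1 + ⟦ a ∧ b ⟧
⟦¬∧¬⟧ true  true  = refl
⟦¬∧¬⟧ true  false = refl
⟦¬∧¬⟧ false true  = refl
⟦¬∧¬⟧ false false = refl

#noConstantFace-inclusionExclusion : ∀ n → ∑ (allFuns n) (λ f → ⟦ noConstantFace f ⟧) ≡
  #noCommonFace true n 1 + #noCommonFace false n 1 - + (2 ℕ.^ (2 ℕ.^ n)) + #bothCommonFaces n 1
#noConstantFace-inclusionExclusion n = begin
  ∑ Fₙ (λ f → ⟦ noConstantFace f ⟧)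
    ≡⟨ ∑-cong Fₙ (λ f → ⟦¬∧¬⟧ (P true f) (P false f)) ⟩
  ∑ Fₙ (λ f → ⟦ not (P true f) ⟧ + ⟦ not (P false f) ⟧ - + 1 + ⟦ P true f ∧ P false f ⟧)
    ≡⟨ ∑-+ Fₙ _ _ ⟩
  ∑ Fₙ (λ f → ⟦ not (P true f) ⟧ + ⟦ not (P false f) ⟧ - + 1) + ∑ Fₙ (λ f → ⟦ P true f ∧ P false f ⟧)
    ≡⟨ cong (_+ ∑ Fₙ (λ f → ⟦ P true f ∧ P false f ⟧))
            (trans (∑-- Fₙ _ _) (cong (_- ∑ Fₙ (λ _ → + 1)) (∑-+ Fₙ _ _))) ⟩
  ∑ Fₙ (λ f → ⟦ not (P true f) ⟧) + ∑ Fₙ (λ f → ⟦ not (P false f) ⟧) - ∑ Fₙ (λ _ → + 1)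
    + ∑ Fₙ (λ f → ⟦ P true f ∧ P false f ⟧)
    ≡⟨ cong₂ _+_ (cong₂ _-_ (cong₂ _+_ (sym (∑-allVecs-1 Fₙ _)) (sym (∑-allVecs-1 Fₙ _))) (#allFuns n))
                 (sym (∑-allVecs-1 Fₙ _)) ⟩
  #noCommonFace true n 1 + #noCommonFace false n 1 - + (2 ℕ.^ (2 ℕ.^ n)) + #bothCommonFaces n 1 ∎
  where
  open ≡-Reasoning
  Fₙ : List (BoolFun n)
  Fₙ = allFuns n
  P : Bool → BoolFun n → Bool
  P c f = hasCommonFace c (f ∷ [])

formulaSum≡binomialTail : ∀ n →
  sumℤ1to n (λ k → (- + 1) ^ k * + (n C k) * + (2 ℕ.^ suc k) * + (2 ℕ.^ (2 ℕ.^ (n ℕ.∸ k)))) ≡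
  + 2 * ∑ (applyUpTo suc n) (λ k → + (n C k) * (- + 2) ^ k * #tuples (n ℕ.∸ k) 1)
formulaSum≡binomialTail n = begin
  sumℤ1to n formulaTerm
    ≡⟨ foldr≡∑ (formulaTerm ∘ suc) (upTo n) ⟩
  ∑ (upTo n) (formulaTerm ∘ suc)
    ≡⟨ ∑-applyUpTo-cong n id suc (formulaTerm ∘ suc) (λ k → + 2 * term k) (λ k _ → termwise (suc k)) ⟩
  ∑ (applyUpTo suc n) (λ k → + 2 * term k)
    ≡⟨ ∑-*ˡ (applyUpTo suc n) (+ 2) term ⟩
  + 2 * ∑ (applyUpTo suc n) term ∎
  where
  open ≡-Reasoning
  formulaTerm term : ℕ → ℤ
  formulaTerm k = (- + 1) ^ k * + (n C k) * + (2 ℕ.^ suc k) * + (2 ℕ.^ (2 ℕ.^ (n ℕ.∸ k)))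
  term k = + (n C k) * (- + 2) ^ k * #tuples (n ℕ.∸ k) 1

  termwise : ∀ k → formulaTerm k ≡ + 2 * term k
  termwise k = begin
    (- + 1) ^ k * + (n C k) * + (2 ℕ.^ suc k) * + M
      ≡⟨ cong (λ p → (- + 1) ^ k * + (n C k) * p * + M) (pos-^ 2 (suc k)) ⟩
    (- + 1) ^ k * + (n C k) * (+ 2 * (+ 2) ^ k) * + M
      ≡⟨ regroup ((- + 1) ^ k) (+ (n C k)) ((+ 2) ^ k) (+ M) ⟩
    + 2 * (+ (n C k) * ((- + 1) ^ k * (+ 2) ^ k) * (+ M * + 1))
      ≡⟨ cong (λ p → + 2 * (+ (n C k) * p * (+ M * + 1))) (^-distribʳ-* (- + 1) (+ 2) k) ⟨
    + 2 * term k ∎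
    where
    M : ℕ
    M = 2 ℕ.^ (2 ℕ.^ (n ℕ.∸ k))
    regroup : ∀ s c p M → s * c * (+ 2 * p) * M ≡ + 2 * (c * (s * p) * (M * + 1))
    regroup = solve-∀

#noConstantFace≡formula : ∀ m → ∑ (allFuns (suc m)) (λ f → ⟦ noConstantFace f ⟧) ≡ formula (suc m)
#noConstantFace≡formula m = begin
  ∑ (allFuns n) (λ f → ⟦ noConstantFace f ⟧)
    ≡⟨ #noConstantFace-inclusionExclusion n ⟩
  #noCommonFace true n 1 + #noCommonFace false n 1 - + N + #bothCommonFaces n 1
    ≡⟨ cong₂ _+_ (cong₂ (λ a b → a + b - + N) (#noCommonFace-closed true n 1) (#noCommonFace-closed false n 1))
                 (#bothCommonFaces-closed n 0) ⟩
  (Bₙ + + 0 - s) + (Bₙ + + 0 - s) - + N + + 2 * + n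
    ≡⟨⟩
  (+ 1 * (+ N * + 1) + S + + 0 - s) + (+ 1 * (+ N * + 1) + S + + 0 - s) - + N + + 2 * + n
    ≡⟨ collect (+ N) S s (+ n) ⟩
  + N - + 2 * (s - + n) + + 2 * S
    ≡⟨ cong (λ x → + N - + 2 * (s - + n) + x) (formulaSum≡binomialTail n) ⟨
  formula n ∎
  where
  open ≡-Reasoning
  n N : ℕ
  n = suc m
  N = 2 ℕ.^ (2 ℕ.^ n)
  s S Bₙ : ℤ
  s = (- + 1) ^ n
  S = ∑ (applyUpTo suc n) (λ k → + (n C k) * (- + 2) ^ k * #tuples (n ℕ.∸ k) 1)
  Bₙ = binomialSum (- + 2) n (λ j → #tuples j 1)

  collect : ∀ N S s k → (+ 1 * (N * + 1) + S + + 0 - s) + (+ 1 * (N * + 1) + S + + 0 - s) - N + + 2 * k ≡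
                        N - + 2 * (s - k) + + 2 * S
  collect = solve-∀

corollary5p2 : (n : ℕ) → (dec : Decidable (NonConstNonCanal {n})) →
    + length (filter dec (allFuns n)) ≡ formula n
corollary5p2 zero    dec = length-filter≡∑ dec (λ _ → false)
  (λ f ncc → ⊥-elim (proj₁ ncc (f [] , λ { [] → refl }))) (λ _ ()) (allFuns 0)
corollary5p2 (suc n) dec = begin
  + length (filter dec (allFuns (suc n)))
    ≡⟨ length-filter≡∑ dec noConstantFace NonConstNonCanal⇒noConstantFace noConstantFace⇒NonConstNonCanal
                       (allFuns (suc n)) ⟩
  ∑ (allFuns (suc n)) (λ f → ⟦ noConstantFace f ⟧)
    ≡⟨ #noConstantFace≡formula n ⟩
  formula (suc n) ∎
  where open ≡-Reasoning
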